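{- There exist two non-isomorphic connected graphs $H_1$ and $H_2$ with $V(H_1)=V(H_2)$ and a vertex set $S\subseteq V(H_1)$ which is a minimum edge resolving set of both $H_1$ and $H_2$, such that $\{\mathrm{code}_S(e): e\in E(H_1)\}=\{\mathrm{code}_S(e'): e'\in E(H_2)\}$, where codes are computed in $H_1$ and $H_2$ respectively.
   Context: All graphs are finite, simple, undirected and connected; $d(u,w)$ is the length of a shortest $u$–$w$ path. For a vertex $v$ and an edge $e=xy$, $d(e,v)=\min\{d(x,v),d(y,v)\}$. For distinct edges $e_1,e_2$, $R_e\{e_1,e_2\}=\{v\in V(G): d(v,e_1)\neq d(v,e_2)\}$. A set $S\subseteq V(G)$ is an edge resolving set if $S\cap R_e\{e_1,e_2\}\neq\emptyset$ for all distinct edges $e_1,e_2$; a minimum edge resolving set is one of minimum cardinality. For an ordered set $U=\{u_1,\dots,u_k\}$ of vertices and an edge $e$, $\mathrm{code}_U(e)=(d(e,u_1),\dots,d(e,u_k))$. -}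

module Defs where

open import Data.Nat using (ℕ; zero; suc; _⊓_; _≤_)
open import Data.Bool using (Bool; true; false; _∧_; _∨_; if_then_else_)
open import Data.Fin using (Fin; _<_)
open import Data.Fin.Subset using (Subset; _∈_; ∣_∣)
open import Data.Fin.Permutation using (Permutation′; _⟨$⟩ʳ_)
open import Data.List using (allFin)
open import Data.Bool.ListAction using (any)
open import Data.Fin using (_≟_)
open import Relation.Nullary.Decidable.Core using (does)
open import Data.Product using (proj₂)
open import Data.Product using (Σ; ∃; ∃-syntax; _×_; _,_; proj₁)
open import Relation.Binary.PropositionalEquality using (_≡_; _≢_)

record Graph (n : ℕ) : Set where
  field
    adj    : Fin n → Fin n → Bool
    adj-sym : ∀ u v → adj u v ≡ adj v u
    irrefl : ∀ u → adj u u ≡ false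
open Graph public

module _ {n : ℕ} (G : Graph n) where

  data Walk : Fin n → Fin n → ℕ → Set where
    nil  : ∀ {u} → Walk u u 0
    cons : ∀ {u v w k} → adj G u v ≡ true → Walk v w k → Walk u w (suc k)

  Connected : Set
  Connected = ∀ u v → ∃[ k ] Walk u v k

  reach : ℕ → Fin n → Fin n → Bool
  reach zero    u w = does (u ≟ w)
  reach (suc k) u w = reach k u w ∨ any (λ x → adj G u x ∧ reach k x w) (allFin n)

  private
    search : Fin n → Fin n → ℕ → ℕ → ℕ
    search u w k zero    = k
    search u w k (suc f) = if reach k u w then k else search u w (suc k) f

  -- d(u,w): length of a shortest u–w path (for connected graphs)
  dist : Fin n → Fin n → ℕ
  dist u w = search u w 0 n

  -- edges, each unordered edge {x,y} represented once with x < y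
  Edge : Set
  Edge = Σ (Fin n × Fin n) λ p → (proj₁ p < proj₂ p) × adj G (proj₁ p) (proj₂ p) ≡ true

  ends : Edge → Fin n × Fin n
  ends = proj₁

  edgeDist : Edge → Fin n → ℕ
  edgeDist ((x , y) , _) v = dist x v ⊓ dist y v

  Resolves : Subset n → Edge → Edge → Set
  Resolves S e₁ e₂ = ∃[ s ] (s ∈ S × edgeDist e₁ s ≢ edgeDist e₂ s)

  EdgeResolving : Subset n → Set
  EdgeResolving S = ∀ e₁ e₂ → ends e₁ ≢ ends e₂ → Resolves S e₁ e₂

  MinEdgeResolving : Subset n → Set
  MinEdgeResolving S = EdgeResolving S × (∀ T → EdgeResolving T → ∣ S ∣ ≤ ∣ T ∣)

Isomorphic : ∀ {n} → Graph n → Graph n → Set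
Isomorphic {n} G H = Σ (Permutation′ n) λ π → ∀ u v → adj G u v ≡ adj H (π ⟨$⟩ʳ u) (π ⟨$⟩ʳ v)

-- code_S(e) in G equals code_S(e') in H (same S, same order of its elements)
SameCode : ∀ {n} (G H : Graph n) → Subset n → Edge G → Edge H → Set
SameCode G H S e e′ = ∀ s → s ∈ S → edgeDist G e s ≡ edgeDist H e′ s

{-# OPTIONS --safe #-}
-- The paw (a triangle 0 1 2 with a pendant vertex 3 at 0) and the 4-cycle 0 2 1 3 live on the
-- same vertex set, but the paw has a vertex of degree 3, so they are not isomorphic.  Measured from
-- S = {1, 2}, the four edges of either graph receive exactly the four codes (0,0), (0,1), (1,0),
-- (1,1), so S is edge resolving in both and the two code sets coincide.  In neither graph does a
-- single vertex resolve all pairs of edges, so S is a minimum edge resolving set of both.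
module Submission where

open import Defs
open import Data.Bool using (Bool; true; false; _∨_)
open import Data.Bool.Properties using (∨-comm)
open import Data.Empty using (⊥-elim)
open import Data.Fin using (Fin)
open import Data.Fin.Patterns using (0F; 1F; 2F; 3F)
open import Data.Fin.Permutation using (Permutation′; _⟨$⟩ʳ_; _⟨$⟩ˡ_; inverseˡ)
open import Data.Fin.Subset using (Subset; _∈_; _⊂_; ∣_∣; ⁅_⁆; _∪_)
open import Data.Fin.Subset.Properties using (x∈⁅x⁆; x∈⁅y⁆⇒x≡y; x≢y⇒x∉⁅y⁆; x∈p∪q⁺; x∈p∪q⁻; p⊂q⇒∣p∣<∣q∣; ∣⁅x⁆∣≡1)
open import Data.Nat using (ℕ; suc; _+_; _≤_; z<s; s<s)
open import Data.Nat.Properties using (+-suc; +-identityʳ) renaming (_≟_ to _≟ℕ_)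
open import Data.Product using (Σ; ∃-syntax; ∃₂; _×_; _,_; proj₁; proj₂)
open import Data.Sum using (_⊎_; inj₁; inj₂)
open import Relation.Nullary using (¬_; yes; no)
open import Relation.Binary.PropositionalEquality
  using (_≡_; _≢_; refl; sym; trans; cong; cong₂; subst; module ≡-Reasoning)

private
  variable
    n : ℕ

fromArcs : (E : Fin n → Fin n → Bool) → (∀ u → E u u ≡ false) → Graph n
fromArcs E loopless = record
  { adj     = λ u v → E u v ∨ E v u
  ; adj-sym = λ u v → ∨-comm (E u v) (E v u)
  ; irrefl  = λ u → cong (λ b → b ∨ b) (loopless u)
  }

module _ {G : Graph n} where

  _++ʷ_ : ∀ {u v w k l} → Walk G u v k → Walk G v w l → Walk G u w (k + l)
  nil      ++ʷ q = q
  cons a p ++ʷ q = cons a (p ++ʷ q)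

  reverseʷ-onto : ∀ {u v w k l} → Walk G v u k → Walk G v w l → Walk G u w (k + l)
  reverseʷ-onto nil acc = acc
  reverseʷ-onto {k = suc k} {l} (cons {u = v} {v = x} a p) acc =
    subst (Walk G _ _) (+-suc k l) (reverseʷ-onto p (cons (trans (adj-sym G x v) a) acc))

  reverseʷ : ∀ {u v k} → Walk G u v k → Walk G v u k
  reverseʷ {k = k} p = subst (Walk G _ _) (+-identityʳ k) (reverseʷ-onto p nil)

  connected-via : (c : Fin n) → (∀ v → ∃[ k ] Walk G c v k) → Connected G
  connected-via c reach u v with reach u | reach v
  ... | k , p | l , q = k + l , reverseʷ p ++ʷ q

two-elements⇒2≤∣p∣ : {p : Subset n} {s t : Fin n} → s ∈ p → t ∈ p → s ≢ t → 2 ≤ ∣ p ∣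
two-elements⇒2≤∣p∣ {p = p} {s} {t} s∈p t∈p s≢t =
  subst (λ m → suc m ≤ ∣ p ∣) (∣⁅x⁆∣≡1 s) (p⊂q⇒∣p∣<∣q∣ ⁅s⁆⊂p)
  where
  ⁅s⁆⊂p : ⁅ s ⁆ ⊂ p
  ⁅s⁆⊂p = (λ x∈⁅s⁆ → subst (_∈ p) (sym (x∈⁅y⁆⇒x≡y s x∈⁅s⁆)) s∈p)
        , t , t∈p , x≢y⇒x∉⁅y⁆ (λ t≡s → s≢t (sym t≡s))

module _ (G : Graph n) where
  open ≡-Reasoning

  NoResolvingVertex : Set
  NoResolvingVertex = ∀ v → ∃₂ λ e₁ e₂ → ends G e₁ ≢ ends G e₂ × edgeDist G e₁ v ≡ edgeDist G e₂ v

  pairCode : Fin n → Fin n → Edge G → ℕ × ℕ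
  pairCode s₁ s₂ e = edgeDist G e s₁ , edgeDist G e s₂

  pair-resolving : (s₁ s₂ : Fin n) (decode : ℕ × ℕ → Fin n × Fin n) →
    (∀ e → decode (pairCode s₁ s₂ e) ≡ ends G e) → EdgeResolving G (⁅ s₁ ⁆ ∪ ⁅ s₂ ⁆)
  pair-resolving s₁ s₂ decode decodes e₁ e₂ e₁≢e₂
    with edgeDist G e₁ s₁ ≟ℕ edgeDist G e₂ s₁ | edgeDist G e₁ s₂ ≟ℕ edgeDist G e₂ s₂
  ... | no ≢₁  | _      = s₁ , x∈p∪q⁺ (inj₁ (x∈⁅x⁆ s₁)) , ≢₁
  ... | yes _  | no ≢₂  = s₂ , x∈p∪q⁺ (inj₂ (x∈⁅x⁆ s₂)) , ≢₂
  ... | yes ≡₁ | yes ≡₂ = ⊥-elim (e₁≢e₂ (begin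
    ends G e₁                    ≡⟨ decodes e₁ ⟨
    decode (pairCode s₁ s₂ e₁)   ≡⟨ cong decode (cong₂ _,_ ≡₁ ≡₂) ⟩
    decode (pairCode s₁ s₂ e₂)   ≡⟨ decodes e₂ ⟩
    ends G e₂                    ∎))

  -- The set must resolve some pair, so it has an element s; the pair left unresolved by s
  -- then forces a second element.
  2≤∣resolving∣ : Fin n → NoResolvingVertex → ∀ T → EdgeResolving G T → 2 ≤ ∣ T ∣
  2≤∣resolving∣ v₀ noVertex T resolving with noVertex v₀
  ... | e₁ , e₂ , e₁≢e₂ , _ with resolving e₁ e₂ e₁≢e₂
  ... | s , s∈T , _ with noVertex s
  ... | f₁ , f₂ , f₁≢f₂ , same-at-s with resolving f₁ f₂ f₁≢f₂
  ... | t , t∈T , differ-at-t =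
    two-elements⇒2≤∣p∣ s∈T t∈T (λ { refl → differ-at-t same-at-s })

pair-sameCode : {G H : Graph n} (s₁ s₂ : Fin n) (e : Edge G) (e′ : Edge H) →
  pairCode G s₁ s₂ e ≡ pairCode H s₁ s₂ e′ → SameCode G H (⁅ s₁ ⁆ ∪ ⁅ s₂ ⁆) e e′
pair-sameCode s₁ s₂ e e′ same s s∈S with x∈p∪q⁻ ⁅ s₁ ⁆ ⁅ s₂ ⁆ s∈S
... | inj₁ s∈⁅s₁⁆ with refl ← x∈⁅y⁆⇒x≡y s₁ s∈⁅s₁⁆ = cong proj₁ same
... | inj₂ s∈⁅s₂⁆ with refl ← x∈⁅y⁆⇒x≡y s₂ s∈⁅s₂⁆ = cong proj₂ same

module _ (G H : Graph n) (s₁ s₂ : Fin n) where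

  code-preserving⇒sameCode : (f : Edge G → Edge H) →
    (∀ e → pairCode G s₁ s₂ e ≡ pairCode H s₁ s₂ (f e)) →
    ∀ e → ∃[ e′ ] SameCode G H (⁅ s₁ ⁆ ∪ ⁅ s₂ ⁆) e e′
  code-preserving⇒sameCode f preserves e = f e , pair-sameCode s₁ s₂ e (f e) (preserves e)

  code-preserving⇒sameCode′ : (g : Edge H → Edge G) →
    (∀ e′ → pairCode G s₁ s₂ (g e′) ≡ pairCode H s₁ s₂ e′) →
    ∀ e′ → ∃[ e ] SameCode G H (⁅ s₁ ⁆ ∪ ⁅ s₂ ⁆) e e′
  code-preserving⇒sameCode′ g preserves e′ = g e′ , pair-sameCode s₁ s₂ (g e′) e′ (preserves e′)

⟨$⟩ʳ-injective : (π : Permutation′ n) {x y : Fin n} → π ⟨$⟩ʳ x ≡ π ⟨$⟩ʳ y → x ≡ y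
⟨$⟩ʳ-injective π {x} {y} πx≡πy =
  trans (sym (inverseˡ π)) (trans (cong (π ⟨$⟩ˡ_) πx≡πy) (inverseˡ π))

module _ (G : Graph n) where

  HasDegree≥3 : Set
  HasDegree≥3 = ∃[ u ] ∃[ x ] ∃[ y ] ∃[ z ]
    adj G u x ≡ true × adj G u y ≡ true × adj G u z ≡ true × x ≢ y × x ≢ z × y ≢ z

  MaxDegree≤2 : Set
  MaxDegree≤2 = ∀ w → ∃₂ λ a b → ∀ p → adj G w p ≡ true → p ≡ a ⊎ p ≡ b

two-of-three-collide : {A : Set} {a b x y z : A} →
  x ≡ a ⊎ x ≡ b → y ≡ a ⊎ y ≡ b → z ≡ a ⊎ z ≡ b → x ≡ y ⊎ x ≡ z ⊎ y ≡ z
two-of-three-collide (inj₁ x≡a) (inj₁ y≡a) _          = inj₁ (trans x≡a (sym y≡a))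
two-of-three-collide (inj₂ x≡b) (inj₂ y≡b) _          = inj₁ (trans x≡b (sym y≡b))
two-of-three-collide (inj₁ x≡a) (inj₂ _)   (inj₁ z≡a) = inj₂ (inj₁ (trans x≡a (sym z≡a)))
two-of-three-collide (inj₁ _)   (inj₂ y≡b) (inj₂ z≡b) = inj₂ (inj₂ (trans y≡b (sym z≡b)))
two-of-three-collide (inj₂ _)   (inj₁ y≡a) (inj₁ z≡a) = inj₂ (inj₂ (trans y≡a (sym z≡a)))
two-of-three-collide (inj₂ x≡b) (inj₁ _)   (inj₂ z≡b) = inj₂ (inj₁ (trans x≡b (sym z≡b)))

degree≥3⇒¬Isomorphic-maxDegree≤2 : (G H : Graph n) → HasDegree≥3 G → MaxDegree≤2 H → ¬ Isomorphic G H
degree≥3⇒¬Isomorphic-maxDegree≤2 G H (u , x , y , z , ux , uy , uz , x≢y , x≢z , y≢z) maxDeg (π , preserves)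
  with maxDeg (π ⟨$⟩ʳ u)
... | a , b , neighbour
  with two-of-three-collide (image ux) (image uy) (image uz)
  where image : ∀ {v} → adj G u v ≡ true → π ⟨$⟩ʳ v ≡ a ⊎ π ⟨$⟩ʳ v ≡ b
        image uv = neighbour _ (trans (sym (preserves u _)) uv)
... | inj₁ πx≡πy        = x≢y (⟨$⟩ʳ-injective π πx≡πy)
... | inj₂ (inj₁ πx≡πz) = x≢z (⟨$⟩ʳ-injective π πx≡πz)
... | inj₂ (inj₂ πy≡πz) = y≢z (⟨$⟩ʳ-injective π πy≡πz)

module Paw where

  arcs : Fin 4 → Fin 4 → Bool
  arcs 0F 1F = true
  arcs 0F 2F = true
  arcs 0F 3F = true
  arcs 1F 2F = true
  arcs _  _  = false

  graph : Graph 4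
  graph = fromArcs arcs λ { 0F → refl ; 1F → refl ; 2F → refl ; 3F → refl }

  e01 e02 e03 e12 : Edge graph
  e01 = (0F , 1F) , z<s , refl
  e02 = (0F , 2F) , z<s , refl
  e03 = (0F , 3F) , z<s , refl
  e12 = (1F , 2F) , s<s z<s , refl

  edge-cases : (P : Edge graph → Set) → P e01 → P e02 → P e03 → P e12 → ∀ e → P e
  edge-cases P p01 p02 p03 p12 ((0F , 1F) , z<s , refl) = p01
  edge-cases P p01 p02 p03 p12 ((0F , 2F) , z<s , refl) = p02
  edge-cases P p01 p02 p03 p12 ((0F , 3F) , z<s , refl) = p03
  edge-cases P p01 p02 p03 p12 ((1F , 2F) , s<s z<s , refl) = p12
  edge-cases P _ _ _ _ ((0F , 0F) , _ , ())
  edge-cases P _ _ _ _ ((1F , 1F) , _ , ())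
  edge-cases P _ _ _ _ ((1F , 3F) , _ , ())
  edge-cases P _ _ _ _ ((2F , 2F) , _ , ())
  edge-cases P _ _ _ _ ((2F , 3F) , _ , ())
  edge-cases P _ _ _ _ ((3F , 3F) , _ , ())
  edge-cases P _ _ _ _ ((1F , 0F) , () , _)
  edge-cases P _ _ _ _ ((2F , 0F) , () , _)
  edge-cases P _ _ _ _ ((3F , 0F) , () , _)
  edge-cases P _ _ _ _ ((2F , 1F) , s<s () , _)
  edge-cases P _ _ _ _ ((3F , 1F) , s<s () , _)
  edge-cases P _ _ _ _ ((3F , 2F) , s<s (s<s ()) , _)

  connected : Connected graph
  connected = connected-via 0F λ
    { 0F → 0 , nil
    ; 1F → 1 , cons refl nil
    ; 2F → 1 , cons refl nil
    ; 3F → 1 , cons refl nil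
    }

  decode : ℕ × ℕ → Fin 4 × Fin 4
  decode (0 , 1) = 0F , 1F
  decode (1 , 0) = 0F , 2F
  decode (1 , 1) = 0F , 3F
  decode _       = 1F , 2F

  resolving : EdgeResolving graph (⁅ 1F ⁆ ∪ ⁅ 2F ⁆)
  resolving = pair-resolving graph 1F 2F decode
    (edge-cases (λ e → decode (pairCode graph 1F 2F e) ≡ ends graph e) refl refl refl refl)

  noResolvingVertex : NoResolvingVertex graph
  noResolvingVertex 0F = e01 , e02 , (λ ()) , refl
  noResolvingVertex 1F = e01 , e12 , (λ ()) , refl
  noResolvingVertex 2F = e01 , e03 , (λ ()) , refl
  noResolvingVertex 3F = e01 , e02 , (λ ()) , refl

  degree≥3 : HasDegree≥3 graph
  degree≥3 = 0F , 1F , 2F , 3F , refl , refl , refl , (λ ()) , (λ ()) , (λ ())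

module Square where

  arcs : Fin 4 → Fin 4 → Bool
  arcs 0F 2F = true
  arcs 0F 3F = true
  arcs 1F 2F = true
  arcs 1F 3F = true
  arcs _  _  = false

  graph : Graph 4
  graph = fromArcs arcs λ { 0F → refl ; 1F → refl ; 2F → refl ; 3F → refl }

  e02 e03 e12 e13 : Edge graph
  e02 = (0F , 2F) , z<s , refl
  e03 = (0F , 3F) , z<s , refl
  e12 = (1F , 2F) , s<s z<s , refl
  e13 = (1F , 3F) , s<s z<s , refl

  edge-cases : (P : Edge graph → Set) → P e02 → P e03 → P e12 → P e13 → ∀ e → P e
  edge-cases P p02 p03 p12 p13 ((0F , 2F) , z<s , refl) = p02
  edge-cases P p02 p03 p12 p13 ((0F , 3F) , z<s , refl) = p03
  edge-cases P p02 p03 p12 p13 ((1F , 2F) , s<s z<s , refl) = p12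
  edge-cases P p02 p03 p12 p13 ((1F , 3F) , s<s z<s , refl) = p13
  edge-cases P _ _ _ _ ((0F , 0F) , _ , ())
  edge-cases P _ _ _ _ ((0F , 1F) , _ , ())
  edge-cases P _ _ _ _ ((1F , 1F) , _ , ())
  edge-cases P _ _ _ _ ((2F , 2F) , _ , ())
  edge-cases P _ _ _ _ ((2F , 3F) , _ , ())
  edge-cases P _ _ _ _ ((3F , 3F) , _ , ())
  edge-cases P _ _ _ _ ((1F , 0F) , () , _)
  edge-cases P _ _ _ _ ((2F , 0F) , () , _)
  edge-cases P _ _ _ _ ((3F , 0F) , () , _)
  edge-cases P _ _ _ _ ((2F , 1F) , s<s () , _)
  edge-cases P _ _ _ _ ((3F , 1F) , s<s () , _)
  edge-cases P _ _ _ _ ((3F , 2F) , s<s (s<s ()) , _)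

  connected : Connected graph
  connected = connected-via 0F λ
    { 0F → 0 , nil
    ; 1F → 2 , cons {v = 2F} refl (cons refl nil)
    ; 2F → 1 , cons refl nil
    ; 3F → 1 , cons refl nil
    }

  decode : ℕ × ℕ → Fin 4 × Fin 4
  decode (1 , 0) = 0F , 2F
  decode (1 , 1) = 0F , 3F
  decode (0 , 0) = 1F , 2F
  decode _       = 1F , 3F

  resolving : EdgeResolving graph (⁅ 1F ⁆ ∪ ⁅ 2F ⁆)
  resolving = pair-resolving graph 1F 2F decode
    (edge-cases (λ e → decode (pairCode graph 1F 2F e) ≡ ends graph e) refl refl refl refl)

  noResolvingVertex : NoResolvingVertex graph
  noResolvingVertex 0F = e02 , e03 , (λ ()) , refl
  noResolvingVertex 1F = e12 , e13 , (λ ()) , refl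
  noResolvingVertex 2F = e02 , e12 , (λ ()) , refl
  noResolvingVertex 3F = e03 , e13 , (λ ()) , refl

  maxDegree≤2 : MaxDegree≤2 graph
  maxDegree≤2 0F = 2F , 3F , λ { 2F _ → inj₁ refl ; 3F _ → inj₂ refl ; 0F () ; 1F () }
  maxDegree≤2 1F = 2F , 3F , λ { 2F _ → inj₁ refl ; 3F _ → inj₂ refl ; 0F () ; 1F () }
  maxDegree≤2 2F = 0F , 1F , λ { 0F _ → inj₁ refl ; 1F _ → inj₂ refl ; 2F () ; 3F () }
  maxDegree≤2 3F = 0F , 1F , λ { 0F _ → inj₁ refl ; 1F _ → inj₂ refl ; 2F () ; 3F () }

paw→square : Edge Paw.graph → Edge Square.graph
paw→square = Paw.edge-cases (λ _ → Edge Square.graph) Square.e13 Square.e02 Square.e03 Square.e12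

paw→square-preserves-code : ∀ e → pairCode Paw.graph 1F 2F e ≡ pairCode Square.graph 1F 2F (paw→square e)
paw→square-preserves-code = Paw.edge-cases
  (λ e → pairCode Paw.graph 1F 2F e ≡ pairCode Square.graph 1F 2F (paw→square e)) refl refl refl refl

square→paw : Edge Square.graph → Edge Paw.graph
square→paw = Square.edge-cases (λ _ → Edge Paw.graph) Paw.e02 Paw.e03 Paw.e12 Paw.e01

square→paw-preserves-code : ∀ e′ → pairCode Paw.graph 1F 2F (square→paw e′) ≡ pairCode Square.graph 1F 2F e′
square→paw-preserves-code = Square.edge-cases
  (λ e′ → pairCode Paw.graph 1F 2F (square→paw e′) ≡ pairCode Square.graph 1F 2F e′) refl refl refl refl

mainTheorem1 : ∃[ n ] Σ (Graph n) λ H₁ → Σ (Graph n) λ H₂ → Σ (Subset n) λ S →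
    Connected H₁ × Connected H₂ × ¬ Isomorphic H₁ H₂
    × MinEdgeResolving H₁ S × MinEdgeResolving H₂ S
    × (∀ (e : Edge H₁) → ∃[ e′ ] SameCode H₁ H₂ S e e′)
    × (∀ (e′ : Edge H₂) → ∃[ e ] SameCode H₁ H₂ S e e′)
mainTheorem1 =
  4 , Paw.graph , Square.graph , ⁅ 1F ⁆ ∪ ⁅ 2F ⁆
  , Paw.connected , Square.connected
  , degree≥3⇒¬Isomorphic-maxDegree≤2 Paw.graph Square.graph Paw.degree≥3 Square.maxDegree≤2
  , (Paw.resolving , 2≤∣resolving∣ Paw.graph 0F Paw.noResolvingVertex)
  , (Square.resolving , 2≤∣resolving∣ Square.graph 0F Square.noResolvingVertex)
  , code-preserving⇒sameCode Paw.graph Square.graph 1F 2F paw→square paw→square-preserves-code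
  , code-preserving⇒sameCode′ Paw.graph Square.graph 1F 2F square→paw square→paw-preserves-code
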